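{- Let $G$ be a finite group and $\mathcal{H}$ a finite multiset of subgroups of $G$. Then $\operatorname{Sha}_{\omega}^{2}(G,J_{G/\mathcal{H}})$ is annihilated by the greatest common divisor of the indices $(G:H)$ for $H\in\mathcal{H}$.
   Context: $J_{G/\mathcal{H}}$ is the cokernel of the $G$-map $\mathbb{Z}\to\bigoplus_{H\in\mathcal{H}}\operatorname{Ind}_H^G\mathbb{Z}$ (with multiplicity) sending $1$ to the constant function $1$ in each summand, where $\operatorname{Ind}_H^G\mathbb{Z}=\mathrm{Hom}_{\mathbb{Z}[H]}(\mathbb{Z}[G],\mathbb{Z})$. $\operatorname{Sha}^2_\omega(G,M):=\ker\big(H^2(G,M)\to\bigoplus_{D}H^2(D,M)\big)$, $D$ ranging over cyclic subgroups of $G$. -}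

module Defs where

open import Data.Nat using (ℕ; zero; suc; _≤ᵇ_)
open import Data.Nat.GCD using (gcd)
open import Data.Integer as ℤ using (ℤ; +_)
open import Data.Fin using (Fin; toℕ)
open import Data.List using (List; filter; length; all)
open import Data.List.Base using (allFin)
open import Data.Bool using (Bool; true; false; not; _∨_; T)
open import Data.Product using (Σ; ∃; ∃-syntax; _×_; _,_)
open import Relation.Binary.PropositionalEquality using (_≡_)
open import Relation.Nullary.Decidable using (Dec)
open import Data.Bool.Properties using (T?)
open import Algebra.Core using (Op₁; Op₂)
open import Algebra.Structures using (IsGroup)

-- Finite groups: a group structure (w.r.t. propositional equality) on
-- Fin n.  Every finite group is isomorphic to one of these.

record FinGroup : Set where
  field
    order   : ℕ
    _∙_     : Op₂ (Fin order)
    ε       : Fin order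
    _⁻¹     : Op₁ (Fin order)
    isGroup : IsGroup _≡_ _∙_ ε _⁻¹

module _ (G : FinGroup) where
  open FinGroup G

  record Subgroup : Set where
    field
      mem    : Fin order → Bool
      ε-mem  : mem ε ≡ true
      ∙-mem  : ∀ x y → mem x ≡ true → mem y ≡ true → mem (x ∙ y) ≡ true
      ⁻¹-mem : ∀ x → mem x ≡ true → mem (x ⁻¹) ≡ true

  -- g is the least element (in the order of Fin) of its right coset H g
  isCosetRep : Subgroup → Fin order → Bool
  isCosetRep H g =
    all (λ h → not (Subgroup.mem H h) ∨ (toℕ g ≤ᵇ toℕ (h ∙ g))) (allFin order)

  index : Subgroup → ℕ
  index H = length (filter (λ g → T? (isCosetRep H g)) (allFin order))

  pow : Fin order → ℕ → Fin order
  pow a zero    = ε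
  pow a (suc m) = a ∙ pow a m

  inCyclic : Fin order → Fin order → Set
  inCyclic a x = ∃[ m ] pow a m ≡ x

  -- Ind_H^G ℤ = Hom_{ℤ[H]}(ℤ[G],ℤ) = {φ : G → ℤ | φ(h x) = φ(x), h ∈ H},
  -- with action (g·φ)(x) = φ(x g).  An element of ⊕ᵢ Ind_{Hᵢ}^G ℤ is a
  -- family of such functions; J is the quotient by the diagonal image of ℤ
  -- (constant functions 1 in every summand), represented by representatives
  -- together with the setoid equality _≈J_.

  module _ {k : ℕ} (Hs : Fin k → Subgroup) where

    Rep : Set
    Rep = Fin k → Fin order → ℤ

    IsInd : Rep → Set
    IsInd u = ∀ i h x → Subgroup.mem (Hs i) h ≡ true → u i (h ∙ x) ≡ u i x

    _≈J_ : Rep → Rep → Set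
    u ≈J v = ∃[ c ] (∀ i x → u i x ≡ v i x ℤ.+ c)

    act : Fin order → Rep → Rep
    act g u i x = u i (x ∙ g)

    _+J_ : Rep → Rep → Rep
    (u +J v) i x = u i x ℤ.+ v i x

    _-J_ : Rep → Rep → Rep
    (u -J v) i x = u i x ℤ.- v i x

    0J : Rep
    0J i x = + 0

    scaleJ : ℕ → Rep → Rep
    scaleJ d u i x = + d ℤ.* u i x

    Cochain1 : Set
    Cochain1 = Σ (Fin order → Rep) (λ b → ∀ g → IsInd (b g))

    Cochain2 : Set
    Cochain2 = Σ (Fin order → Fin order → Rep) (λ c → ∀ g h → IsInd (c g h))

    IsCocycle : Cochain2 → Set
    IsCocycle (c , _) = ∀ g h l →
      (((act g (c h l) -J c (g ∙ h) l) +J c g (h ∙ l)) -J c g h) ≈J 0J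

    δ : Cochain1 → Fin order → Fin order → Rep
    δ (b , _) g h = (act g (b h) -J b (g ∙ h)) +J b g

    IsCoboundary : Cochain2 → Set
    IsCoboundary (c , _) = ∃[ b ] (∀ g h → c g h ≈J δ b g h)

    -- the restriction of c to the cyclic subgroup ⟨a⟩ is a coboundary there
    -- (a 1-cochain on ⟨a⟩ is the restriction of one on G)
    IsCoboundaryOnCyclic : Fin order → Cochain2 → Set
    IsCoboundaryOnCyclic a (c , _) =
      ∃[ b ] (∀ g h → inCyclic a g → inCyclic a h → c g h ≈J δ b g h)

    InSha2ω : Cochain2 → Set
    InSha2ω c = IsCocycle c × (∀ a → IsCoboundaryOnCyclic a c)

    scale2 : ℕ → Cochain2 → Cochain2
    scale2 d (c , ci) = (λ g h → scaleJ d (c g h)) ,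
      λ g h i x y m → Relation.Binary.PropositionalEquality.cong (+ d ℤ.*_) (ci g h i x y m)

  -- gcd of a finite family of naturals (gcd of the empty family is 0)
gcdFam : ∀ {k} → (Fin k → ℕ) → ℕ
gcdFam {zero}  f = 0
gcdFam {suc k} f = gcd (f Fin.zero) (gcdFam (λ i → f (Fin.suc i)))

{-# OPTIONS --safe #-}
-- Let H be a member of the family and P = ⊕ Ind, so that J = P / ℤ. Evaluation of the H-summand
-- at the identity coset is an H-equivariant retraction P → ℤ, so over H the class of c lifts to a
-- P-valued cocycle ĉ. Averaging over H gives |H| ĉ = δA. If s ∈ H fixes the point z of Hⱼ \ G,
-- then m ↦ (A − |H| b)(sᵐ)(z), with δb = ĉ on ⟨s⟩, is additive on the finite group ⟨s⟩, hence 0;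
-- so A(s)(z) is divisible by |H|. Correcting A by δ of a 0-cochain read off on double coset
-- representatives Hⱼ z H makes it divisible by |H| on H, and A / |H| bounds ĉ. Hence res_H c is a
-- coboundary, so is (G : H) c = cor (res c), and Bézout passes to the gcd of the indices.
module Submission where

open import Defs
open import Algebra.Bundles using (Group)
import Algebra.Properties.Group as GroupProperties
import Algebra.Properties.CommutativeMonoid.Sum as CommutativeMonoidSum
import Algebra.Properties.Semiring.Sum as SemiringSum
open import Algebra.Structures using (IsGroup)
open import Data.Bool using (Bool; true; false; not; _∨_; T)
open import Data.Bool.Properties using (T?)
import Data.Bool.Properties as Boolₚ
open import Data.Fin using (Fin; zero; suc; toℕ)
import Data.Fin.Properties as Finₚ
import Data.Fin.Permutation as Permutation
open import Data.Integer using (ℤ; +_; _+_; _-_; _*_; -_)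
import Data.Integer.Properties as ℤₚ
open import Data.Integer.Divisibility.Signed
  using (_∣_; _∣?_; divides; quotient; ∣-refl; ∣m⇒∣m*n; ∣m∣n⇒∣m+n; ∣m∣n⇒∣m-n)
open import Data.Integer.Tactic.RingSolver using (solve-∀)
open import Data.Nat as ℕ using (ℕ; zero; suc; _≤_; z≤n; s≤s)
import Data.Nat.Properties as ℕₚ
open import Data.Nat.GCD using (gcd; gcd-GCD; module Bézout)
import Data.List.Relation.Unary.All.Properties as All
import Data.List.Properties as Listₚ
open import Data.List.Membership.Propositional using (lose)
open import Data.List.Membership.Propositional.Properties using (∈-allFin)
open import Data.List using (allFin; filter; length; tabulate)
open import Data.Product using (∃; ∃-syntax; _×_; _,_; proj₁; proj₂)
open import Function using (_∘_; id; _⇔_; mk⇔; Equivalence)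
import Function.Construct.Identity as Identity
open import Relation.Binary.PropositionalEquality
open import Relation.Nullary using (Dec; yes; no; contradiction; _×-dec_)
open import Relation.Unary using (Pred; Decidable)

Least : ∀ {n p} → Pred (Fin n) p → Fin n → Set p
Least P y = P y × (∀ z → P z → toℕ y ≤ toℕ z)

least : ∀ {n p} {P : Pred (Fin n) p} → Decidable P → ∀ x → P x → ∃ (Least P)
least {suc n} P? x Px with P? zero
... | yes P0 = zero , P0 , λ _ _ → z≤n
least {suc n} P? zero    Px | no ¬P0 = contradiction Px ¬P0
least {suc n} P? (suc x) Px | no ¬P0 with least (P? ∘ suc) x Px
... | y , Py , minimal = suc y , Py , λ
  { zero Pz → contradiction Pz ¬P0
  ; (suc z) Pz → s≤s (minimal z Pz) }

Least-unique : ∀ {n p q} {P : Pred (Fin n) p} {Q : Pred (Fin n) q} {y y'} →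
               (∀ z → P z ⇔ Q z) → Least P y → Least Q y' → y ≡ y'
Least-unique P⇔Q (Py , P-minimal) (Qy' , Q-minimal) =
  Finₚ.toℕ-injective (ℕₚ.≤-antisym (P-minimal _ (Equivalence.from (P⇔Q _) Qy')) (Q-minimal _ (Equivalence.to (P⇔Q _) Py)))

open CommutativeMonoidSum ℤₚ.+-0-commutativeMonoid using (sum; sum-cong-≗; ∑-distrib-+; ∑-permute; sum-replicate-zero)
open SemiringSum ℤₚ.+-*-semiring using (*-distribˡ-sum)

module _ {n : ℕ} where

  sum-neg : (f : Fin n → ℤ) → sum (λ x → - f x) ≡ - sum f
  sum-neg f = begin
    sum (λ x → - f x)           ≡⟨ sum-cong-≗ (λ x → sym (ℤₚ.-1*i≡-i (f x))) ⟩
    sum (λ x → -1ℤ * f x)       ≡⟨ sym (*-distribˡ-sum -1ℤ f) ⟩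
    -1ℤ * sum f                 ≡⟨ ℤₚ.-1*i≡-i (sum f) ⟩
    - sum f                     ∎
    where open ≡-Reasoning
          -1ℤ = - + 1

  sum-minus : (f g : Fin n → ℤ) → sum (λ x → f x - g x) ≡ sum f - sum g
  sum-minus f g = trans (∑-distrib-+ f (λ x → - g x)) (cong (λ z → sum f + z) (sum-neg g))

  sum-zero : (f : Fin n → ℤ) → (∀ x → f x ≡ + 0) → sum f ≡ + 0
  sum-zero f f≡0 = trans (sum-cong-≗ f≡0) (sum-replicate-zero n)

  sum-reindex : (f : Fin n → ℤ) (π π⁻¹ : Fin n → Fin n) →
                (∀ x → π (π⁻¹ x) ≡ x) → (∀ x → π⁻¹ (π x) ≡ x) → sum (f ∘ π) ≡ sum f
  sum-reindex f π π⁻¹ ππ⁻¹ π⁻¹π = sym (∑-permute f (Permutation.permutation π π⁻¹ ππ⁻¹ π⁻¹π))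

𝟙 : Bool → ℤ
𝟙 true  = + 1
𝟙 false = + 0

length-filter-tabulate : ∀ {a} {A : Set a} {n} (p : A → Bool) (f : Fin n → A) →
                         + length (filter (T? ∘ p) (tabulate f)) ≡ sum (𝟙 ∘ p ∘ f)
length-filter-tabulate {n = zero}  p f = refl
length-filter-tabulate {n = suc n} p f with p (f zero)
... | true  = trans (ℤₚ.pos-+ 1 _) (cong (λ m → + 1 + m) (length-filter-tabulate p (f ∘ suc)))
... | false = trans (length-filter-tabulate p (f ∘ suc)) (sym (ℤₚ.+-identityˡ _))

exactQuotient : ℤ → ℤ → ℤ
exactQuotient d x with d ∣? x
... | yes d∣x = quotient d∣x
... | no  _   = + 0

exactQuotient-spec : ∀ {d x} → d ∣ x → x ≡ exactQuotient d x * d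
exactQuotient-spec {d} {x} d∣x with d ∣? x
... | yes d∣x' = _∣_.equality d∣x'
... | no  d∤x  = contradiction d∣x d∤x

pos-difference : ∀ {d} x a y b → d ℕ.+ y ℕ.* b ≡ x ℕ.* a → + d ≡ + x * + a - + y * + b
pos-difference {d} x a y b eq = begin
  + d                                 ≡⟨ cancel (+ d) (+ y * + b) ⟩
  (+ d + + y * + b) - + y * + b       ≡⟨ cong (λ v → (+ d + v) - + y * + b) (sym (ℤₚ.pos-* y b)) ⟩
  (+ d + + (y ℕ.* b)) - + y * + b     ≡⟨ cong (_- + y * + b) (sym (ℤₚ.pos-+ d (y ℕ.* b))) ⟩
  + (d ℕ.+ y ℕ.* b) - + y * + b       ≡⟨ cong (λ v → + v - + y * + b) eq ⟩
  + (x ℕ.* a) - + y * + b             ≡⟨ cong (_- + y * + b) (ℤₚ.pos-* x a) ⟩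
  + x * + a - + y * + b               ∎
  where
    open ≡-Reasoning
    cancel : ∀ d e → d ≡ (d + e) - e
    cancel = solve-∀

module GroupLemmas (G : FinGroup) where

  open FinGroup G public
  open IsGroup isGroup public using (assoc; identityˡ; identityʳ; inverseˡ; inverseʳ)
  private
    group : Group _ _
    group = record { isGroup = isGroup }

  open GroupProperties group public
    using (⁻¹-involutive; ⁻¹-anti-homo-∙; x∙y⁻¹≈ε⇒x≈y; ∙-cancelʳ;
           \\-leftDividesˡ; \\-leftDividesʳ; //-rightDividesˡ; //-rightDividesʳ)

  El : Set
  El = Fin order

  infix 4 _∈_ _∈?_
  _∈_ : El → Subgroup G → Set
  x ∈ H = Subgroup.mem H x ≡ true

  _∈?_ : ∀ x H → Dec (x ∈ H)
  x ∈? H = Subgroup.mem H x Boolₚ.≟ true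

  module SubgroupClosure (H : Subgroup G) where

    ε∈ : ε ∈ H
    ε∈ = Subgroup.ε-mem H

    ∙∈ : ∀ {x y} → x ∈ H → y ∈ H → x ∙ y ∈ H
    ∙∈ = Subgroup.∙-mem H _ _

    ⁻¹∈ : ∀ {x} → x ∈ H → x ⁻¹ ∈ H
    ⁻¹∈ = Subgroup.⁻¹-mem H _

    ∈-cancelʳ : ∀ {h x} → h ∈ H → x ∙ h ∈ H → x ∈ H
    ∈-cancelʳ {h} {x} h∈ xh∈ = subst (_∈ H) (//-rightDividesʳ h x) (∙∈ xh∈ (⁻¹∈ h∈))

    ∈-cancelˡ : ∀ {h x} → h ∈ H → h ∙ x ∈ H → x ∈ H
    ∈-cancelˡ {h} {x} h∈ hx∈ = subst (_∈ H) (\\-leftDividesʳ h x) (∙∈ (⁻¹∈ h∈) hx∈)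

    mem-∙ˡ : ∀ {h} x → h ∈ H → Subgroup.mem H (h ∙ x) ≡ Subgroup.mem H x
    mem-∙ˡ x h∈ = Boolₚ.⇔→≡ (mk⇔ (∈-cancelˡ h∈) (∙∈ h∈))

    mem-∙ʳ : ∀ {h} x → h ∈ H → Subgroup.mem H (x ∙ h) ≡ Subgroup.mem H x
    mem-∙ʳ x h∈ = Boolₚ.⇔→≡ (mk⇔ (∈-cancelʳ h∈) (λ x∈ → ∙∈ x∈ h∈))

    mem⇒⇔ : ∀ {x y} → Subgroup.mem H x ≡ Subgroup.mem H y → x ∈ H ⇔ y ∈ H
    mem⇒⇔ mem-x≡mem-y = mk⇔ (trans (sym mem-x≡mem-y)) (trans mem-x≡mem-y)

    InCoset : El → El → Set
    InCoset y z = z ∙ (y ⁻¹) ∈ H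

    InCoset-refl : ∀ y → InCoset y y
    InCoset-refl y = subst (_∈ H) (sym (inverseʳ y)) ε∈

    InCoset-sym : ∀ {y z} → InCoset y z → InCoset z y
    InCoset-sym {y} {z} zy⁻¹∈ = subst (_∈ H) (trans (⁻¹-anti-homo-∙ z (y ⁻¹)) (cong (_∙ (z ⁻¹)) (⁻¹-involutive y)))
                                      (⁻¹∈ zy⁻¹∈)

    InCoset-∙ˡ : ∀ {a} y z → a ∈ H → InCoset (a ∙ y) z ⇔ InCoset y z
    InCoset-∙ˡ {a} y z a∈ = mem⇒⇔ (begin
      Subgroup.mem H (z ∙ ((a ∙ y) ⁻¹))         ≡⟨ cong (λ w → Subgroup.mem H (z ∙ w)) (⁻¹-anti-homo-∙ a y) ⟩
      Subgroup.mem H (z ∙ ((y ⁻¹) ∙ (a ⁻¹)))    ≡⟨ cong (Subgroup.mem H) (sym (assoc z _ _)) ⟩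
      Subgroup.mem H ((z ∙ (y ⁻¹)) ∙ (a ⁻¹))    ≡⟨ mem-∙ʳ _ (⁻¹∈ a∈) ⟩
      Subgroup.mem H (z ∙ (y ⁻¹))               ∎)
      where open ≡-Reasoning

    InCoset-point-∙ˡ : ∀ {a} y z → a ∈ H → InCoset y (a ∙ z) ⇔ InCoset y z
    InCoset-point-∙ˡ {a} y z a∈ = mem⇒⇔ (trans (cong (Subgroup.mem H) (assoc a z (y ⁻¹))) (mem-∙ˡ _ a∈))

    pow∈ : ∀ {a} m → a ∈ H → pow G a m ∈ H
    pow∈ zero    a∈ = ε∈
    pow∈ (suc m) a∈ = ∙∈ a∈ (pow∈ m a∈)

  pow-+ : ∀ s m n → pow G s (m ℕ.+ n) ≡ pow G s m ∙ pow G s n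
  pow-+ s zero    n = sym (identityˡ _)
  pow-+ s (suc m) n = trans (cong (s ∙_) (pow-+ s m n)) (sym (assoc s _ _))

  pow-order : ∀ s → ∃[ d ] pow G s (suc d) ≡ ε
  pow-order s with Finₚ.pigeonhole (ℕₚ.n<1+n order) (pow G s ∘ toℕ)
  ... | i , j , i<j , sⁱ≡sʲ = d , ∙-cancelʳ (pow G s (toℕ i)) _ _ (begin
      pow G s (suc d) ∙ pow G s (toℕ i)  ≡⟨ sym (pow-+ s (suc d) (toℕ i)) ⟩
      pow G s (suc d ℕ.+ toℕ i)          ≡⟨ cong (pow G s) d+i+1≡j ⟩
      pow G s (toℕ j)                    ≡⟨ sym sⁱ≡sʲ ⟩
      pow G s (toℕ i)                    ≡⟨ sym (identityˡ _) ⟩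
      ε ∙ pow G s (toℕ i)                ∎)
    where
      open ≡-Reasoning
      d = toℕ j ℕ.∸ suc (toℕ i)
      d+i+1≡j : suc d ℕ.+ toℕ i ≡ toℕ j
      d+i+1≡j = trans (cong suc (ℕₚ.+-comm d (toℕ i))) (ℕₚ.m+[n∸m]≡n i<j)

module Cochains (G : FinGroup) {k : ℕ} (Hs : Fin k → Subgroup G) where

  open GroupLemmas G public

  C¹ : Set
  C¹ = El → Rep G Hs

  C² : Set
  C² = El → El → Rep G Hs

  δ₀ : Rep G Hs → C¹
  δ₀ w g i x = w i (x ∙ g) - w i x

  δ₁ : C¹ → C²
  δ₁ b g h i x = (b h i (x ∙ g) - b (g ∙ h) i x) + b g i x

  δ₂ : C² → El → El → El → Rep G Hs
  δ₂ c g h l i x = ((c h l i (x ∙ g) - c (g ∙ h) l i x) + c g (h ∙ l) i x) - c g h i x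

  δ₁-minus : ∀ a b g h i x → δ₁ (λ g i x → a g i x - b g i x) g h i x ≡ δ₁ a g h i x - δ₁ b g h i x
  δ₁-minus a b g h i x = identity (a h i (x ∙ g)) (b h i (x ∙ g)) (a (g ∙ h) i x) (b (g ∙ h) i x) (a g i x) (b g i x)
    where
      identity : ∀ a a' b b' d d' → ((a - a') - (b - b')) + (d - d') ≡ ((a - b) + d) - ((a' - b') + d')
      identity = solve-∀

  δ₁-* : ∀ m a g h i x → δ₁ (λ g i x → m * a g i x) g h i x ≡ m * δ₁ a g h i x
  δ₁-* m a g h i x = identity m (a h i (x ∙ g)) (a (g ∙ h) i x) (a g i x)
    where
      identity : ∀ m a b d → (m * a - m * b) + m * d ≡ m * ((a - b) + d)
      identity = solve-∀

  δ₁∘δ₀ : ∀ w g h i x → δ₁ (δ₀ w) g h i x ≡ + 0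
  δ₁∘δ₀ w g h i x rewrite assoc x g h = identity (w i (x ∙ (g ∙ h))) (w i (x ∙ g)) (w i x)
    where
      identity : ∀ a b c → ((a - b) - (a - c)) + (b - c) ≡ + 0
      identity = solve-∀

  δ₂∘δ₁ : ∀ b g h l i x → δ₂ (δ₁ b) g h l i x ≡ + 0
  δ₂∘δ₁ b g h l i x
    rewrite assoc x g h | assoc g h l = identity (b l i (x ∙ (g ∙ h))) (b (h ∙ l) i (x ∙ g)) (b h i (x ∙ g))
                                                 (b (g ∙ (h ∙ l)) i x) (b (g ∙ h) i x) (b g i x)
    where
      identity : ∀ a b c d e f → ((((a - b) + c) - ((a - d) + e)) + ((b - d) + f)) - ((c - e) + f) ≡ + 0
      identity = solve-∀

  δ₂-minus : ∀ c e g h l i x → δ₂ (λ g h i x → c g h i x - e g h i x) g h l i x ≡ δ₂ c g h l i x - δ₂ e g h l i x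
  δ₂-minus c e g h l i x = identity (c h l i (x ∙ g)) (e h l i (x ∙ g)) (c (g ∙ h) l i x) (e (g ∙ h) l i x)
                                (c g (h ∙ l) i x) (e g (h ∙ l) i x) (c g h i x) (e g h i x)
    where
      identity : ∀ a a' b b' d d' f f' →
        (((a - a') - (b - b')) + (d - d')) - (f - f') ≡ (((a - b) + d) - f) - (((a' - b') + d') - f')
      identity = solve-∀

  IsInd-act : ∀ {u} g → IsInd G Hs u → IsInd G Hs (act G Hs g u)
  IsInd-act {u} g u-ind i a y a∈ = trans (cong (u i) (assoc a y g)) (u-ind i a (y ∙ g) a∈)

  IsInd-+ : ∀ {u v} → IsInd G Hs u → IsInd G Hs v → IsInd G Hs (_+J_ G Hs u v)
  IsInd-+ u-ind v-ind i a x a∈ = cong₂ _+_ (u-ind i a x a∈) (v-ind i a x a∈)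

  IsInd-minus : ∀ {u v} → IsInd G Hs u → IsInd G Hs v → IsInd G Hs (_-J_ G Hs u v)
  IsInd-minus u-ind v-ind i a x a∈ = cong₂ _-_ (u-ind i a x a∈) (v-ind i a x a∈)

  IsInd-* : ∀ {u} n → IsInd G Hs u → IsInd G Hs (λ i x → n * u i x)
  IsInd-* n u-ind i a x a∈ = cong (n *_) (u-ind i a x a∈)

  IsInd-sum : ∀ {m} {u : Fin m → Rep G Hs} → (∀ r → IsInd G Hs (u r)) → IsInd G Hs (λ i x → sum (λ r → u r i x))
  IsInd-sum u-ind i a x a∈ = sum-cong-≗ (λ r → u-ind r i a x a∈)

  δ₁-ind : ∀ {b} → (∀ g → IsInd G Hs (b g)) → ∀ g h → IsInd G Hs (δ₁ b g h)
  δ₁-ind b-ind g h = IsInd-+ (IsInd-minus (IsInd-act g (b-ind h)) (b-ind (g ∙ h))) (b-ind g)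

  IsConstant : Rep G Hs → Set
  IsConstant u = ∃[ a ] ∀ i x → u i x ≡ a

  -- The P-notions hold pointwise in ⊕ Ind, the J-notions up to constants, i.e. in J.
  IsPCocycleOn : (El → Set) → C² → Set
  IsPCocycleOn S c = ∀ {g h l} → S g → S h → S l → ∀ i x → δ₂ c g h l i x ≡ + 0

  IsPCoboundaryOn : (El → Set) → C² → Set
  IsPCoboundaryOn S c = ∃[ b ] (∀ g → IsInd G Hs (b g)) × (∀ {g h} → S g → S h → ∀ i x → c g h i x ≡ δ₁ b g h i x)

  IsJCoboundaryOn : (El → Set) → C² → Set
  IsJCoboundaryOn S c = ∃[ b ] (∀ g → IsInd G Hs (b g)) × (∀ {g h} → S g → S h → IsConstant (_-J_ G Hs (c g h) (δ₁ b g h)))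

  Annihilates : ℕ → C² → Set
  Annihilates d c = ∃[ b ] (∀ g → IsInd G Hs (b g)) × (∀ g h → IsConstant (λ i x → + d * c g h i x - δ₁ b g h i x))

  IsConstant-resp : ∀ {u v} → (∀ i x → u i x ≡ v i x) → IsConstant v → IsConstant u
  IsConstant-resp u≗v (a , v≡a) = a , λ i x → trans (u≗v i x) (v≡a i x)

  IsConstant-0 : IsConstant (0J G Hs)
  IsConstant-0 = + 0 , λ _ _ → refl

  IsConstant-+ : ∀ {u v} → IsConstant u → IsConstant v → IsConstant (_+J_ G Hs u v)
  IsConstant-+ (a , p) (b , q) = a + b , λ i x → cong₂ _+_ (p i x) (q i x)

  IsConstant-minus : ∀ {u v} → IsConstant u → IsConstant v → IsConstant (_-J_ G Hs u v)
  IsConstant-minus (a , p) (b , q) = a - b , λ i x → cong₂ _-_ (p i x) (q i x)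

  IsConstant-swap : ∀ {u v} → IsConstant (_-J_ G Hs u v) → IsConstant (_-J_ G Hs v u)
  IsConstant-swap {u} {v} (a , u-v≡a) = - a , λ i x → trans (negate (v i x) (u i x)) (cong -_ (u-v≡a i x))
    where
      negate : ∀ a b → a - b ≡ - (b - a)
      negate = solve-∀

  IsConstant-* : ∀ {u} (n : ℤ) → IsConstant u → IsConstant (λ i x → n * u i x)
  IsConstant-* n (a , p) = n * a , λ i x → cong (n *_) (p i x)

  IsConstant-act : ∀ {u} g → IsConstant u → IsConstant (act G Hs g u)
  IsConstant-act g (a , p) = a , λ i x → p i (x ∙ g)

  IsConstant-sum : ∀ {n} {u : Fin n → Rep G Hs} → (∀ r → IsConstant (u r)) → IsConstant (λ i x → sum (λ r → u r i x))
  IsConstant-sum u-const = sum (proj₁ ∘ u-const) , λ i x → sum-cong-≗ (λ r → proj₂ (u-const r) i x)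

  ≈J⇒IsConstant : ∀ {u v} → _≈J_ G Hs u v → IsConstant (_-J_ G Hs u v)
  ≈J⇒IsConstant {u} {v} (a , u≡v+a) = a , λ i x → trans (cong (_- v i x) (u≡v+a i x)) (identity (v i x) a)
    where
      identity : ∀ b a → (b + a) - b ≡ a
      identity = solve-∀

  IsConstant⇒≈J : ∀ {u v} → IsConstant (_-J_ G Hs u v) → _≈J_ G Hs u v
  IsConstant⇒≈J {u} {v} (a , u-v≡a) = a , λ i x → trans (sym (identity (u i x) (v i x))) (cong (_+_ (v i x)) (u-v≡a i x))
    where
      identity : ∀ a b → b + (a - b) ≡ a
      identity = solve-∀

  sumSecond : (El → ℤ) → (El → El) → C² → C¹
  sumSecond w σ c g i y = sum (λ r → w r * c g (σ r) i y)

  δ₁-sumSecond : ∀ w σ c g h i y →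
    δ₁ (sumSecond w σ c) g h i y
    ≡ (sum w * c g h i y + sum (λ r → w r * δ₂ c g h (σ r) i y))
      - (sum (λ r → w r * c g (h ∙ σ r) i y) - sumSecond w σ c g i y)
  δ₁-sumSecond w σ c g h i y =
    identity (sumSecond w σ c h i (y ∙ g)) (sumSecond w σ c (g ∙ h) i y) (sumSecond w σ c g i y)
             (sum (λ r → w r * c g (h ∙ σ r) i y)) (c g h i y) (sum w) sum-δ₂
    where
      open ≡-Reasoning
      A B D : El → ℤ
      A r = c h (σ r) i (y ∙ g)
      B r = c (g ∙ h) (σ r) i y
      D r = c g (h ∙ σ r) i y
      C = c g h i y
      wx : (El → ℤ) → El → ℤ
      wx f r = w r * f r
      sum-δ₂ : sum (λ r → w r * δ₂ c g h (σ r) i y) ≡ ((sum (wx A) - sum (wx B)) + sum (wx D)) - C * sum w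
      sum-δ₂ = begin
        sum (λ r → w r * (((A r - B r) + D r) - C))
          ≡⟨ sum-cong-≗ (λ r → distribute (w r) (A r) (B r) (D r) C) ⟩
        sum (λ r → ((wx A r - wx B r) + wx D r) - C * w r)
          ≡⟨ sum-minus (λ r → (wx A r - wx B r) + wx D r) (λ r → C * w r) ⟩
        sum (λ r → (wx A r - wx B r) + wx D r) - sum (λ r → C * w r)
          ≡⟨ cong₂ _-_ (trans (∑-distrib-+ (λ r → wx A r - wx B r) (wx D)) (cong (_+ sum (wx D)) (sum-minus (wx A) (wx B))))
                       (sym (*-distribˡ-sum C w)) ⟩
        ((sum (wx A) - sum (wx B)) + sum (wx D)) - C * sum w
          ∎
        where
          distribute : ∀ w a b d e → w * (((a - b) + d) - e) ≡ ((w * a - w * b) + w * d) - e * w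
          distribute = solve-∀
      identity : ∀ bh bgh bg t c n {s} → s ≡ ((bh - bgh) + t) - c * n → (bh - bgh) + bg ≡ (n * c + s) - (t - bg)
      identity bh bgh bg t c n refl = ring bh bgh bg t c n
        where
          ring : ∀ bh bgh bg t c n → (bh - bgh) + bg ≡ (n * c + (((bh - bgh) + t) - c * n)) - (t - bg)
          ring = solve-∀

  cocycle-vanishes-on-stabilizer :
    ∀ {s} (f : C¹) → (∀ g → IsInd G Hs (f g)) →
    (∀ {g h} → inCyclic G s g → inCyclic G s h → ∀ i y → δ₁ f g h i y ≡ + 0) →
    ∀ {j z a} → a ∈ Hs j → z ∙ s ≡ a ∙ z → f s j z ≡ + 0
  cocycle-vanishes-on-stabilizer {s} f f-ind f-cocycle {j} {z} {a} a∈ zs≡az with pow-order s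
  ... | d , s^[d+1]≡ε = ℤₚ.*-cancelˡ-≡ (+ suc d) (f s j z) (+ 0) (begin
    + suc d * f s j z        ≡⟨ sym (f-pow (suc d)) ⟩
    f (pow G s (suc d)) j z  ≡⟨ cong (λ g → f g j z) s^[d+1]≡ε ⟩
    f ε j z                  ≡⟨ f-ε j z ⟩
    + 0                      ≡⟨ sym (ℤₚ.*-zeroʳ (+ suc d)) ⟩
    + suc d * + 0            ∎)
    where
      open ≡-Reasoning
      f-ε : ∀ i y → f ε i y ≡ + 0
      f-ε i y = begin
        f ε i y
          ≡⟨ sym (ℤₚ.+-identityˡ _) ⟩
        + 0 + f ε i y
          ≡⟨ cong (_+ f ε i y) (sym (ℤₚ.+-inverseʳ (f ε i y))) ⟩
        (f ε i y - f ε i y) + f ε i y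
          ≡⟨ cong₂ (λ y' g → (f ε i y' - f g i y) + f ε i y) (sym (identityʳ y)) (sym (identityˡ ε)) ⟩
        δ₁ f ε ε i y
          ≡⟨ f-cocycle (0 , refl) (0 , refl) i y ⟩
        + 0
          ∎
      f-pow : ∀ m → f (pow G s m) j z ≡ + m * f s j z
      f-pow zero    = f-ε j z
      f-pow (suc m) = begin
        f (s ∙ pow G s m) j z
          ≡⟨ solve-for-δ₁ (f (pow G s m) j (z ∙ s)) _ (f s j z) (f-cocycle (1 , identityʳ s) (m , refl) j z) ⟩
        f (pow G s m) j (z ∙ s) + f s j z
          ≡⟨ cong (λ y → f (pow G s m) j y + f s j z) zs≡az ⟩
        f (pow G s m) j (a ∙ z) + f s j z
          ≡⟨ cong (_+ f s j z) (trans (f-ind _ j a z a∈) (f-pow m)) ⟩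
        + m * f s j z + f s j z
          ≡⟨ sym (trans (ℤₚ.suc-* (+ m) (f s j z)) (ℤₚ.+-comm (f s j z) _)) ⟩
        + suc m * f s j z
          ∎
        where
          solve-for-δ₁ : ∀ x y w → (x - y) + w ≡ + 0 → y ≡ x + w
          solve-for-δ₁ x y w e = trans (ring x y w) (trans (cong (_-_ (x + w)) e) (ℤₚ.+-identityʳ (x + w)))
            where
              ring : ∀ x y w → y ≡ (x + w) - ((x - y) + w)
              ring = solve-∀

  IsCocycle⇒δ₂-constant : ∀ c → IsCocycle G Hs c → ∀ g h l → IsConstant (δ₂ (proj₁ c) g h l)
  IsCocycle⇒δ₂-constant c cocycle g h l =
    IsConstant-resp (λ i x → sym (ℤₚ.+-identityʳ _)) (≈J⇒IsConstant {v = 0J G Hs} (cocycle g h l))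

  IsCoboundaryOnCyclic⇒IsJCoboundaryOn : ∀ c {a} → IsCoboundaryOnCyclic G Hs a c → IsJCoboundaryOn (inCyclic G a) (proj₁ c)
  IsCoboundaryOnCyclic⇒IsJCoboundaryOn c ((b , b-ind) , c≈δb) = b , b-ind , λ g∈ h∈ → ≈J⇒IsConstant (c≈δb _ _ g∈ h∈)

  Annihilates⇒IsCoboundary : ∀ d c → Annihilates d (proj₁ c) → IsCoboundary G Hs (scale2 G Hs d c)
  Annihilates⇒IsCoboundary d c (b , b-ind , d·c≈δb) = (b , b-ind) , λ g h → IsConstant⇒≈J (d·c≈δb g h)

  Annihilates-0 : ∀ c → Annihilates 0 c
  Annihilates-0 c = (λ _ → 0J G Hs) , (λ _ _ _ _ _ → refl) , λ _ _ → IsConstant-0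

  Annihilates-combination : ∀ {c a b d} → Annihilates a c → Annihilates b c →
                            ∀ x y → + d ≡ x * + a + y * + b → Annihilates d c
  Annihilates-combination {c} {a} {b} (βa , βa-ind , βa-spec) (βb , βb-ind , βb-spec) x y d≡ =
    (λ g i z → x * βa g i z + y * βb g i z) ,
    (λ g → IsInd-+ (IsInd-* x (βa-ind g)) (IsInd-* y (βb-ind g))) ,
    λ g h → IsConstant-resp
      (λ i z → trans (cong (λ m → m * c g h i z - _) d≡)
                     (identity x y (+ a) (+ b) (c g h i z) (βa h i (z ∙ g)) (βa (g ∙ h) i z) (βa g i z)
                               (βb h i (z ∙ g)) (βb (g ∙ h) i z) (βb g i z)))
      (IsConstant-+ (IsConstant-* x (βa-spec g h)) (IsConstant-* y (βb-spec g h)))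
    where
      identity : ∀ x y A B c p₁ q₁ r₁ p₂ q₂ r₂ →
        (x * A + y * B) * c - (((x * p₁ + y * p₂) - (x * q₁ + y * q₂)) + (x * r₁ + y * r₂))
        ≡ x * (A * c - ((p₁ - q₁) + r₁)) + y * (B * c - ((p₂ - q₂) + r₂))
      identity = solve-∀

  Annihilates-gcd : ∀ {c a b} → Annihilates a c → Annihilates b c → Annihilates (gcd a b) c
  Annihilates-gcd {c} {a} {b} ann-a ann-b with Bézout.identity (gcd-GCD a b)
  ... | Bézout.+- x y eq = Annihilates-combination ann-a ann-b (+ x) (- + y)
                             (trans (pos-difference x a y b eq) (rearrange (+ x) (+ a) (+ y) (+ b)))
    where
      rearrange : ∀ x a y b → x * a - y * b ≡ x * a + - y * b
      rearrange = solve-∀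
  ... | Bézout.-+ x y eq = Annihilates-combination ann-a ann-b (- + x) (+ y)
                             (trans (pos-difference y b x a eq) (rearrange (+ y) (+ b) (+ x) (+ a)))
    where
      rearrange : ∀ y b x a → y * b - x * a ≡ - x * a + y * b
      rearrange = solve-∀

  Annihilates-gcdFam : ∀ {c m} (d : Fin m → ℕ) → (∀ i → Annihilates (d i) c) → Annihilates (gcdFam d) c
  Annihilates-gcdFam {c} {zero}  d ann = Annihilates-0 c
  Annihilates-gcdFam {c} {suc m} d ann =
    Annihilates-gcd {c} {d zero} {gcdFam (d ∘ suc)} (ann zero) (Annihilates-gcdFam (d ∘ suc) (ann ∘ suc))

module RightCosets (G : FinGroup) (H : Subgroup G) where

  open GroupLemmas G
  open SubgroupClosure H

  private
    least-in-coset : ∀ y → ∃ (Least (InCoset y))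
    least-in-coset y = least (λ z → z ∙ (y ⁻¹) ∈? H) y (InCoset-refl y)

  rep : El → El
  rep = proj₁ ∘ least-in-coset

  rep-least : ∀ y → Least (InCoset y) (rep y)
  rep-least = proj₂ ∘ least-in-coset

  rep∈ : ∀ y → rep y ∙ (y ⁻¹) ∈ H
  rep∈ = proj₁ ∘ rep-least

  rep-∙ˡ : ∀ {a} y → a ∈ H → rep (a ∙ y) ≡ rep y
  rep-∙ˡ y a∈ = Least-unique (λ z → InCoset-∙ˡ y z a∈) (rep-least (_ ∙ y)) (rep-least y)

  isCosetRep⇒least : ∀ {y} → isCosetRep G H y ≡ true → ∀ h → h ∈ H → toℕ y ≤ toℕ (h ∙ y)
  isCosetRep⇒least {y} y-rep h h∈ =
    ℕₚ.≤ᵇ⇒≤ _ _ (subst (λ b → T (not b ∨ _)) h∈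
                   (All.tabulate⁻ (All.all⁺ _ (allFin order) (Equivalence.from Boolₚ.T-≡ y-rep)) h))

  least⇒isCosetRep : ∀ {y} → (∀ h → h ∈ H → toℕ y ≤ toℕ (h ∙ y)) → isCosetRep G H y ≡ true
  least⇒isCosetRep {y} y-least = Equivalence.to Boolₚ.T-≡ (All.all⁻ _ (All.tabulate⁺ pointwise))
    where
      pointwise : ∀ h → T (not (Subgroup.mem H h) ∨ (toℕ y ℕ.≤ᵇ toℕ (h ∙ y)))
      pointwise h with Subgroup.mem H h in h∈
      ... | false = _
      ... | true  = ℕₚ.≤⇒≤ᵇ (y-least h h∈)

  isCosetRep-rep : ∀ y → isCosetRep G H (rep y) ≡ true
  isCosetRep-rep y = least⇒isCosetRep λ h h∈ →
    proj₂ (rep-least y) (h ∙ rep y) (subst (_∈ H) (sym (assoc h (rep y) (y ⁻¹))) (∙∈ h∈ (rep∈ y)))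

  rep-isCosetRep : ∀ {y} → isCosetRep G H y ≡ true → rep y ≡ y
  rep-isCosetRep {y} y-rep = Least-unique (λ _ → Identity.⇔-id _) (rep-least y)
    ( InCoset-refl y
    , λ z z∈ → subst (λ w → toℕ y ≤ toℕ w) (//-rightDividesˡ y z) (isCosetRep⇒least y-rep _ z∈))

  rep-idem : ∀ y → rep (rep y) ≡ rep y
  rep-idem y = rep-isCosetRep (isCosetRep-rep y)

  rep-rep∙ : ∀ y g → rep (rep y ∙ g) ≡ rep (y ∙ g)
  rep-rep∙ y g = begin
    rep (rep y ∙ g)                            ≡⟨ cong (λ w → rep (w ∙ g)) (sym (//-rightDividesˡ y (rep y))) ⟩
    rep (((rep y ∙ (y ⁻¹)) ∙ y) ∙ g)           ≡⟨ cong rep (assoc _ y g) ⟩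
    rep ((rep y ∙ (y ⁻¹)) ∙ (y ∙ g))           ≡⟨ rep-∙ˡ (y ∙ g) (rep∈ y) ⟩
    rep (y ∙ g)                                ∎
    where open ≡-Reasoning

  τ θ : El → El
  τ x = rep (x ⁻¹) ⁻¹
  θ x = rep (x ⁻¹) ∙ x

  τθ : ∀ x → τ x ∙ θ x ≡ x
  τθ x = \\-leftDividesʳ (rep (x ⁻¹)) x

  θ∈ : ∀ x → θ x ∈ H
  θ∈ x = subst (λ w → rep (x ⁻¹) ∙ w ∈ H) (⁻¹-involutive x) (rep∈ (x ⁻¹))

  rep-⁻¹-∙ʳ : ∀ x {h} → h ∈ H → rep ((x ∙ h) ⁻¹) ≡ rep (x ⁻¹)
  rep-⁻¹-∙ʳ x {h} h∈ = trans (cong rep (⁻¹-anti-homo-∙ x h)) (rep-∙ˡ (x ⁻¹) (⁻¹∈ h∈))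

  τ-∙ʳ : ∀ x {h} → h ∈ H → τ (x ∙ h) ≡ τ x
  τ-∙ʳ x h∈ = cong _⁻¹ (rep-⁻¹-∙ʳ x h∈)

  θ-∙ʳ : ∀ x {h} → h ∈ H → θ (x ∙ h) ≡ θ x ∙ h
  θ-∙ʳ x {h} h∈ = trans (cong (_∙ (x ∙ h)) (rep-⁻¹-∙ʳ x h∈)) (sym (assoc _ x h))

  τ-∈ : ∀ {h} → h ∈ H → τ h ≡ τ ε
  τ-∈ {h} h∈ = trans (cong τ (sym (identityˡ h))) (τ-∙ʳ ε h∈)

  τε∈ : τ ε ∈ H
  τε∈ = ∈-cancelʳ (θ∈ ε) (subst (_∈ H) (sym (τθ ε)) ε∈)

  η : El → El
  η x = x ∙ (rep x ⁻¹)

  η∈ : ∀ x → η x ∈ H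
  η∈ x = subst (_∈ H) (trans (⁻¹-anti-homo-∙ (rep x) (x ⁻¹)) (cong (_∙ (rep x ⁻¹)) (⁻¹-involutive x)))
                      (⁻¹∈ (rep∈ x))

  isCosetRep⇔η≡ε : ∀ {y} → isCosetRep G H y ≡ true ⇔ η y ≡ ε
  isCosetRep⇔η≡ε {y} = mk⇔
    (λ y-rep → trans (cong (λ w → y ∙ (w ⁻¹)) (rep-isCosetRep y-rep)) (inverseʳ y))
    (λ η≡ε → subst (λ w → isCosetRep G H w ≡ true) (sym (x∙y⁻¹≈ε⇒x≈y y (rep y) η≡ε)) (isCosetRep-rep y))

  -- A permutation of all of G (so that sums can be reindexed along it) sending the
  -- representative of H x to the representative of H x g.
  cosetShift : El → El → El
  cosetShift g x = η x ∙ rep (rep x ∙ g)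

  rep-cosetShift : ∀ g x → rep (cosetShift g x) ≡ rep (rep x ∙ g)
  rep-cosetShift g x = trans (rep-∙ˡ _ (η∈ x)) (rep-idem _)

  η-cosetShift : ∀ g x → η (cosetShift g x) ≡ η x
  η-cosetShift g x = trans (cong (λ w → cosetShift g x ∙ (w ⁻¹)) (rep-cosetShift g x)) (//-rightDividesʳ _ (η x))

  cosetShift-∙ : ∀ g g' x → cosetShift g (cosetShift g' x) ≡ η x ∙ rep (rep x ∙ (g' ∙ g))
  cosetShift-∙ g g' x = cong₂ _∙_ (η-cosetShift g' x) (begin
    rep (rep (cosetShift g' x) ∙ g)    ≡⟨ cong (λ w → rep (w ∙ g)) (rep-cosetShift g' x) ⟩
    rep (rep (rep x ∙ g') ∙ g)         ≡⟨ rep-rep∙ (rep x ∙ g') g ⟩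
    rep ((rep x ∙ g') ∙ g)             ≡⟨ cong rep (assoc (rep x) g' g) ⟩
    rep (rep x ∙ (g' ∙ g))             ∎)
    where open ≡-Reasoning

  cosetShift-inverse : ∀ g g' x → g' ∙ g ≡ ε → cosetShift g (cosetShift g' x) ≡ x
  cosetShift-inverse g g' x g'g≡ε = begin
    cosetShift g (cosetShift g' x)   ≡⟨ cosetShift-∙ g g' x ⟩
    η x ∙ rep (rep x ∙ (g' ∙ g))     ≡⟨ cong (λ w → η x ∙ rep (rep x ∙ w)) g'g≡ε ⟩
    η x ∙ rep (rep x ∙ ε)            ≡⟨ cong (λ w → η x ∙ rep w) (identityʳ (rep x)) ⟩
    η x ∙ rep (rep x)                ≡⟨ cong (η x ∙_) (rep-idem x) ⟩
    η x ∙ rep x                      ≡⟨ //-rightDividesˡ (rep x) x ⟩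
    x                                ∎
    where open ≡-Reasoning

  isCosetRep-cosetShift : ∀ g x → isCosetRep G H (cosetShift g x) ≡ isCosetRep G H x
  isCosetRep-cosetShift g x = Boolₚ.⇔→≡ (mk⇔
    (λ shifted-rep → Equivalence.from isCosetRep⇔η≡ε
                       (trans (sym (η-cosetShift g x)) (Equivalence.to isCosetRep⇔η≡ε shifted-rep)))
    (λ x-rep → Equivalence.from isCosetRep⇔η≡ε
                 (trans (η-cosetShift g x) (Equivalence.to isCosetRep⇔η≡ε x-rep))))

  cosetShift-isCosetRep : ∀ g {x} → isCosetRep G H x ≡ true → cosetShift g x ≡ rep (x ∙ g)
  cosetShift-isCosetRep g {x} x-rep =
    trans (cong₂ (λ a b → a ∙ rep (b ∙ g)) (Equivalence.to isCosetRep⇔η≡ε x-rep) (rep-isCosetRep x-rep))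
          (identityˡ _)

module Corestriction (G : FinGroup) {k : ℕ} (Hs : Fin k → Subgroup G) (H : Subgroup G) where

  open Cochains G Hs
  open SubgroupClosure H
  open RightCosets G H

  isRep : El → ℤ
  isRep = 𝟙 ∘ isCosetRep G H

  sum-isRep : sum isRep ≡ + index G H
  sum-isRep = sym (length-filter-tabulate (isCosetRep G H) id)

  sum-isRep-cosetShift : ∀ g (f : El → ℤ) → sum (λ r → isRep r * f (cosetShift g r)) ≡ sum (λ r → isRep r * f r)
  sum-isRep-cosetShift g f = begin
    sum (λ r → isRep r * f (cosetShift g r))
      ≡⟨ sum-cong-≗ (λ r → cong (λ b → 𝟙 b * f (cosetShift g r)) (sym (isCosetRep-cosetShift g r))) ⟩
    sum ((λ r → isRep r * f r) ∘ cosetShift g)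
      ≡⟨ sum-reindex _ (cosetShift g) (cosetShift (g ⁻¹))
                     (λ x → cosetShift-inverse g (g ⁻¹) x (inverseˡ g))
                     (λ x → cosetShift-inverse (g ⁻¹) g x (inverseʳ g)) ⟩
    sum (λ r → isRep r * f r)
      ∎
    where open ≡-Reasoning

  sum-isRep-∙ʳ : (F : C¹) → (∀ a y → a ∈ H → IsConstant (_-J_ G Hs (F (a ∙ y)) (F y))) →
                 ∀ g → IsConstant (λ i z → sum (λ r → isRep r * F (r ∙ g) i z) - sum (λ r → isRep r * F r i z))
  sum-isRep-∙ʳ F F-invariant g = IsConstant-resp as-sum (IsConstant-sum shifted-term)
    where
      shifted-term : ∀ r → IsConstant (λ i z → 𝟙 (isCosetRep G H r) * (F (r ∙ g) i z - F (cosetShift g r) i z))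
      shifted-term r with isCosetRep G H r in r-rep
      ... | false = IsConstant-0
      ... | true  = IsConstant-resp (λ i z → trans (ℤₚ.*-identityˡ _) (cong (λ w → F (r ∙ g) i z - F w i z) rg≡))
                                    (IsConstant-swap {F (a ∙ (r ∙ g))} (F-invariant a (r ∙ g) (rep∈ (r ∙ g))))
        where
          a = rep (r ∙ g) ∙ ((r ∙ g) ⁻¹)
          rg≡ : cosetShift g r ≡ a ∙ (r ∙ g)
          rg≡ = trans (cosetShift-isCosetRep g r-rep) (sym (//-rightDividesˡ (r ∙ g) (rep (r ∙ g))))
      as-sum : ∀ i z → sum (λ r → isRep r * F (r ∙ g) i z) - sum (λ r → isRep r * F r i z)
                       ≡ sum (λ r → isRep r * (F (r ∙ g) i z - F (cosetShift g r) i z))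
      as-sum i z = begin
        sum (λ r → isRep r * F (r ∙ g) i z) - sum (λ r → isRep r * F r i z)
          ≡⟨ cong (_-_ (sum (λ r → isRep r * F (r ∙ g) i z))) (sym (sum-isRep-cosetShift g (λ r → F r i z))) ⟩
        sum (λ r → isRep r * F (r ∙ g) i z) - sum (λ r → isRep r * F (cosetShift g r) i z)
          ≡⟨ sym (sum-minus (λ r → isRep r * F (r ∙ g) i z) (λ r → isRep r * F (cosetShift g r) i z)) ⟩
        sum (λ r → isRep r * F (r ∙ g) i z - isRep r * F (cosetShift g r) i z)
          ≡⟨ sum-cong-≗ (λ r → factor (isRep r) _ _) ⟩
        sum (λ r → isRep r * (F (r ∙ g) i z - F (cosetShift g r) i z))
          ∎
        where
          open ≡-Reasoning
          factor : ∀ w a b → w * a - w * b ≡ w * (a - b)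
          factor = solve-∀

  module _ (c : C²) (c-ind : ∀ g h → IsInd G Hs (c g h))
           (c-cocycle : ∀ g h l → IsConstant (δ₂ c g h l))
           (c-splits : IsJCoboundaryOn (_∈ H) c) where

    private
      β : C¹
      β = proj₁ c-splits

      β-ind : ∀ g → IsInd G Hs (β g)
      β-ind = proj₁ (proj₂ c-splits)

      β-splits : ∀ {g h} → g ∈ H → h ∈ H → IsConstant (_-J_ G Hs (c g h) (δ₁ β g h))
      β-splits = proj₂ (proj₂ c-splits)

    -- γ extends β along the left transversal τ, so that c' = c − δγ vanishes in J on G × H.
    γ : C¹
    γ x i y = (β (θ x) i (y ∙ τ x) - c (τ x) (θ x) i y) + β (τ ε) i y

    γ-ind : ∀ x → IsInd G Hs (γ x)
    γ-ind x = IsInd-+ (IsInd-minus (IsInd-act (τ x) (β-ind (θ x))) (c-ind _ _)) (β-ind (τ ε))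

    c' : C²
    c' g h = _-J_ G Hs (c g h) (δ₁ γ g h)

    c'-ind : ∀ g h → IsInd G Hs (c' g h)
    c'-ind g h = IsInd-minus (c-ind g h) (δ₁-ind γ-ind g h)

    c'-cocycle : ∀ g h l → IsConstant (δ₂ c' g h l)
    c'-cocycle g h l =
      IsConstant-resp (λ i y → trans (δ₂-minus c (δ₁ γ) g h l i y) (cong (_-_ (δ₂ c g h l i y)) (δ₂∘δ₁ γ g h l i y)))
                      (IsConstant-minus (c-cocycle g h l) IsConstant-0)

    c'-vanishes-on-H : ∀ x {h} → h ∈ H → IsConstant (c' x h)
    c'-vanishes-on-H x {h} h∈ =
      IsConstant-resp expand
        (IsConstant-+ (IsConstant-minus (IsConstant-act l (β-splits (θ∈ x) h∈)) (c-cocycle l t h))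
                      (IsConstant-act x (β-splits τε∈ (θ∈ h))))
      where
        l = τ x
        t = θ x
        l₀ = τ ε
        E : El → El → Rep G Hs
        E g h = _-J_ G Hs (c g h) (δ₁ β g h)
        -- identity receives the group equations (x = l ∙ t, τ h = l₀, …) as equations between atoms.
        expand : ∀ i y → c' x h i y ≡ (E t h i (y ∙ l) - δ₂ c l t h i y) + E l₀ (θ h) i (y ∙ x)
        expand i y = identity (β t i (y ∙ l)) (c l t i y) (c t h i (y ∙ l))
          (cong (λ w → c w h i y) (sym (τθ x)))
          (cong (λ w → β (θ h) i ((y ∙ x) ∙ w)) (τ-∈ h∈))
          (cong (λ w → c w (θ h) i (y ∙ x)) (τ-∈ h∈))
          (cong₂ (λ w v → β w i (y ∙ v)) (θ-∙ʳ x h∈) (τ-∙ʳ x h∈))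
          (cong₂ (λ w v → c v w i y) (θ-∙ʳ x h∈) (τ-∙ʳ x h∈))
          (cong₂ (λ w v → β w i v) (sym (trans (cong (_∙ θ h) (sym (τ-∈ h∈))) (τθ h)))
                                   (trans (assoc y l t) (cong (y ∙_) (τθ x))))
          where
            identity : ∀ {cx cx' βθ βθ' cθ cθ' βxh βxh' cxh cxh' βh βh' βl₀ βl₀'} βt clt cth →
              cx ≡ cx' → βθ ≡ βθ' → cθ ≡ cθ' → βxh ≡ βxh' → cxh ≡ cxh' → βh ≡ βh' →
              cx - ((((βθ - cθ) + βl₀) - ((βxh - cxh) + βl₀')) + ((βt - clt) + βl₀'))
              ≡ (((cth - ((βh - βxh') + βt)) - (((cth - cx') + cxh') - clt)) + (cθ' - ((βθ' - βh') + βl₀)))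
            identity {cx} {_} {βθ} {_} {cθ} {_} {βxh} {_} {cxh} {_} {βh} {_} {βl₀} {βl₀'} βt clt cth
                     refl refl refl refl refl refl = ring cx βθ cθ βxh cxh βh βl₀ βl₀' βt clt cth
              where
                ring : ∀ cx βθ cθ βxh cxh βh βl₀ βl₀' βt clt cth →
                  cx - ((((βθ - cθ) + βl₀) - ((βxh - cxh) + βl₀')) + ((βt - clt) + βl₀'))
                  ≡ (((cth - ((βh - βxh) + βt)) - (((cth - cx) + cxh) - clt)) + (cθ - ((βθ - βh) + βl₀)))
                ring = solve-∀

    c'-∙ʳ : ∀ g x {h} → h ∈ H → IsConstant (_-J_ G Hs (c' g (x ∙ h)) (c' g x))
    c'-∙ʳ g x {h} h∈ =
      IsConstant-resp (λ i y → identity (c' x h i (y ∙ g)) (c' (g ∙ x) h i y) (c' g (x ∙ h) i y) (c' g x i y))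
        (IsConstant-+ (IsConstant-minus (c'-cocycle g x h) (IsConstant-act g (c'-vanishes-on-H x h∈)))
                      (c'-vanishes-on-H (g ∙ x) h∈))
      where
        identity : ∀ a b c d → c - d ≡ ((((a - b) + c) - d) - a) + b
        identity = solve-∀

    transferred : C¹
    transferred = sumSecond isRep _⁻¹ c'

    transferred-ind : ∀ g → IsInd G Hs (transferred g)
    transferred-ind g = IsInd-sum (λ r → IsInd-* (isRep r) (c'-ind g (r ⁻¹)))

    index·c'-δ₁transferred : ∀ g h → IsConstant (λ i y → sum isRep * c' g h i y - δ₁ transferred g h i y)
    index·c'-δ₁transferred g h =
      IsConstant-resp
        (λ i y → trans (cong (_-_ (sum isRep * c' g h i y)) (δ₁-sumSecond isRep _⁻¹ c' g h i y))
                       (identity (sum isRep) (c' g h i y) (S∂ i y) (Σc i y - transferred g i y)))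
        (IsConstant-minus {λ i y → Σc i y - transferred g i y} {S∂} Σc-const S∂-const)
      where
        Σc S∂ : Rep G Hs
        Σc i y = sum (λ r → isRep r * c' g (h ∙ (r ⁻¹)) i y)
        S∂ i y = sum (λ r → isRep r * δ₂ c' g h (r ⁻¹) i y)
        S∂-const : IsConstant S∂
        S∂-const = IsConstant-sum (λ r → IsConstant-* (isRep r) (c'-cocycle g h (r ⁻¹)))
        h∙r⁻¹ : ∀ r → h ∙ (r ⁻¹) ≡ (r ∙ (h ⁻¹)) ⁻¹
        h∙r⁻¹ r = sym (trans (⁻¹-anti-homo-∙ r (h ⁻¹)) (cong (_∙ (r ⁻¹)) (⁻¹-involutive h)))
        c'-invariant : ∀ a y → a ∈ H → IsConstant (_-J_ G Hs (c' g ((a ∙ y) ⁻¹)) (c' g (y ⁻¹)))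
        c'-invariant a y a∈ = IsConstant-resp (λ i z → cong (λ w → c' g w i z - c' g (y ⁻¹) i z) (⁻¹-anti-homo-∙ a y))
                                              (c'-∙ʳ g (y ⁻¹) (⁻¹∈ a∈))
        Σc-const : IsConstant (λ i y → Σc i y - transferred g i y)
        Σc-const = IsConstant-resp
          (λ i y → cong (_- transferred g i y) (sum-cong-≗ (λ r → cong (λ w → isRep r * c' g w i y) (h∙r⁻¹ r))))
          (sum-isRep-∙ʳ (λ z → c' g (z ⁻¹)) c'-invariant (h ⁻¹))
        identity : ∀ m c s t → m * c - ((m * c + s) - t) ≡ t - s
        identity = solve-∀

    cobounding : C¹
    cobounding g i y = transferred g i y + sum isRep * γ g i y

    index-annihilates : Annihilates (index G H) c
    index-annihilates =
      cobounding ,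
      (λ g → IsInd-+ (transferred-ind g) (IsInd-* (sum isRep) (γ-ind g))) ,
      λ g h → IsConstant-resp
        (λ i y → trans (cong (λ m → m * c g h i y - δ₁ cobounding g h i y) (sym sum-isRep))
                       (identity (sum isRep) (c g h i y) (transferred h i (y ∙ g)) (transferred (g ∙ h) i y)
                                 (transferred g i y) (γ h i (y ∙ g)) (γ (g ∙ h) i y) (γ g i y)))
        (index·c'-δ₁transferred g h)
      where
        identity : ∀ m c th tgh tg γh γgh γg →
          m * c - (((th + m * γh) - (tgh + m * γgh)) + (tg + m * γg))
          ≡ m * (c - ((γh - γgh) + γg)) - ((th - tgh) + tg)
        identity = solve-∀

module DoubleCosets (G : FinGroup) {k : ℕ} (Hs : Fin k → Subgroup G) (H : Subgroup G) where

  open GroupLemmas G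
  open SubgroupClosure H using (ε∈; ∙∈; ⁻¹∈)
  open module Hⱼ j = SubgroupClosure (Hs j) using (InCoset)

  InDoubleCoset : Fin k → El → El → Set
  InDoubleCoset j y z = ∃[ t ] t ∈ H × InCoset j (y ∙ t) z

  InDoubleCoset-∙ˡ : ∀ j {a} y z → a ∈ Hs j → InDoubleCoset j (a ∙ y) z ⇔ InDoubleCoset j y z
  InDoubleCoset-∙ˡ j {a} y z a∈ = mk⇔
    (λ (t , t∈ , p) → t , t∈ , Equivalence.to (via t) p)
    (λ (t , t∈ , p) → t , t∈ , Equivalence.from (via t) p)
    where
      via : ∀ t → InCoset j ((a ∙ y) ∙ t) z ⇔ InCoset j (y ∙ t) z
      via t = subst (λ w → InCoset j w z ⇔ InCoset j (y ∙ t) z) (sym (assoc a y t)) (Hⱼ.InCoset-∙ˡ j (y ∙ t) z a∈)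

  InDoubleCoset-∙ʳ : ∀ j y {g} z → g ∈ H → InDoubleCoset j (y ∙ g) z ⇔ InDoubleCoset j y z
  InDoubleCoset-∙ʳ j y {g} z g∈ = mk⇔
    (λ (t , t∈ , p) → g ∙ t , ∙∈ g∈ t∈ , subst (λ w → InCoset j w z) (assoc y g t) p)
    (λ (t , t∈ , p) → (g ⁻¹) ∙ t , ∙∈ (⁻¹∈ g∈) t∈ ,
                      subst (λ w → InCoset j w z) (sym (trans (assoc y g _) (cong (y ∙_) (\\-leftDividesˡ g t)))) p)

  private
    least-in-doubleCoset : ∀ j y → ∃ (Least (InDoubleCoset j y))
    least-in-doubleCoset j y =
      least (λ z → Finₚ.any? (λ t → (t ∈? H) ×-dec (z ∙ ((y ∙ t) ⁻¹) ∈? Hs j)))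
            y (ε , ε∈ , subst (λ w → InCoset j w y) (sym (identityʳ y)) (Hⱼ.InCoset-refl j y))

  doubleRep : Fin k → El → El
  doubleRep j y = proj₁ (least-in-doubleCoset j y)

  doubleRep-∈ : ∀ j y → InDoubleCoset j y (doubleRep j y)
  doubleRep-∈ j y = proj₁ (proj₂ (least-in-doubleCoset j y))

  doubleRep-∙ˡ : ∀ j {a} y → a ∈ Hs j → doubleRep j (a ∙ y) ≡ doubleRep j y
  doubleRep-∙ˡ j y a∈ = Least-unique (λ z → InDoubleCoset-∙ˡ j y z a∈)
                                     (proj₂ (least-in-doubleCoset j _)) (proj₂ (least-in-doubleCoset j y))

  doubleRep-∙ʳ : ∀ j y {g} → g ∈ H → doubleRep j (y ∙ g) ≡ doubleRep j y
  doubleRep-∙ʳ j y g∈ = Least-unique (λ z → InDoubleCoset-∙ʳ j y z g∈)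
                                     (proj₂ (least-in-doubleCoset j _)) (proj₂ (least-in-doubleCoset j y))

  Offset : Fin k → El → El → Set
  Offset j y t = t ∈ H × InCoset j (doubleRep j y ∙ t) y

  private
    least-offset : ∀ j y → ∃ (Least (Offset j y))
    least-offset j y with doubleRep-∈ j y
    ... | t , t∈ , z∈ = least (λ t → (t ∈? H) ×-dec (y ∙ ((z ∙ t) ⁻¹) ∈? Hs j))
                              (t ⁻¹) (⁻¹∈ t∈ , subst (_∈ Hs j) regroup (Hⱼ.InCoset-sym j z∈))
      where
        z = doubleRep j y
        regroup : (y ∙ t) ∙ (z ⁻¹) ≡ y ∙ ((z ∙ (t ⁻¹)) ⁻¹)
        regroup = trans (assoc y t (z ⁻¹))
                        (cong (y ∙_) (sym (trans (⁻¹-anti-homo-∙ z (t ⁻¹)) (cong (_∙ (z ⁻¹)) (⁻¹-involutive t)))))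

  offset : Fin k → El → El
  offset j y = proj₁ (least-offset j y)

  offset-∈ : ∀ j y → Offset j y (offset j y)
  offset-∈ j y = proj₁ (proj₂ (least-offset j y))

  offset-∙ˡ : ∀ j {a} y → a ∈ Hs j → offset j (a ∙ y) ≡ offset j y
  offset-∙ˡ j {a} y a∈ = Least-unique equivalent (proj₂ (least-offset j _)) (proj₂ (least-offset j y))
    where
      equivalent : ∀ t → Offset j (a ∙ y) t ⇔ Offset j y t
      equivalent t rewrite doubleRep-∙ˡ j y a∈ = mk⇔
        (λ (t∈ , p) → t∈ , Equivalence.to (Hⱼ.InCoset-point-∙ˡ j _ y a∈) p)
        (λ (t∈ , p) → t∈ , Equivalence.from (Hⱼ.InCoset-point-∙ˡ j _ y a∈) p)

  cofactor : Fin k → El → El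
  cofactor j y = y ∙ ((doubleRep j y ∙ offset j y) ⁻¹)

  cofactor-∈ : ∀ j y → cofactor j y ∈ Hs j
  cofactor-∈ j y = proj₂ (offset-∈ j y)

  doubleCoset-decomposition : ∀ j y → y ≡ cofactor j y ∙ (doubleRep j y ∙ offset j y)
  doubleCoset-decomposition j y = sym (//-rightDividesˡ (doubleRep j y ∙ offset j y) y)

  transition : Fin k → El → El → El
  transition j y g = (offset j y ∙ g) ∙ (offset j (y ∙ g) ⁻¹)

  transition-∈ : ∀ j y {g} → g ∈ H → transition j y g ∈ H
  transition-∈ j y g∈ = ∙∈ (∙∈ (proj₁ (offset-∈ j y)) g∈) (⁻¹∈ (proj₁ (offset-∈ j (_ ∙ _))))

  transition-offset : ∀ j y g → transition j y g ∙ offset j (y ∙ g) ≡ offset j y ∙ g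
  transition-offset j y g = //-rightDividesˡ (offset j (y ∙ g)) (offset j y ∙ g)

  transition-stabilizes : ∀ j y {g} → g ∈ H →
    doubleRep j y ∙ transition j y g ≡ ((cofactor j y ⁻¹) ∙ cofactor j (y ∙ g)) ∙ doubleRep j y
  transition-stabilizes j y {g} g∈ = begin
    z ∙ ((t ∙ g) ∙ (t₂ ⁻¹))                  ≡⟨ sym (assoc z (t ∙ g) _) ⟩
    (z ∙ (t ∙ g)) ∙ (t₂ ⁻¹)                  ≡⟨ cong (_∙ (t₂ ⁻¹)) (sym (assoc z t g)) ⟩
    ((z ∙ t) ∙ g) ∙ (t₂ ⁻¹)                  ≡⟨ cong (λ v → (v ∙ g) ∙ (t₂ ⁻¹)) (sym (\\-leftDividesʳ a (z ∙ t))) ⟩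
    (((a ⁻¹) ∙ (a ∙ (z ∙ t))) ∙ g) ∙ (t₂ ⁻¹)  ≡⟨ cong (λ v → (((a ⁻¹) ∙ v) ∙ g) ∙ (t₂ ⁻¹)) (sym (doubleCoset-decomposition j y)) ⟩
    (((a ⁻¹) ∙ y) ∙ g) ∙ (t₂ ⁻¹)             ≡⟨ cong (_∙ (t₂ ⁻¹)) (assoc (a ⁻¹) y g) ⟩
    ((a ⁻¹) ∙ (y ∙ g)) ∙ (t₂ ⁻¹)             ≡⟨ assoc (a ⁻¹) (y ∙ g) _ ⟩
    (a ⁻¹) ∙ ((y ∙ g) ∙ (t₂ ⁻¹))             ≡⟨ cong (λ v → (a ⁻¹) ∙ (v ∙ (t₂ ⁻¹))) yg≡ ⟩
    (a ⁻¹) ∙ ((a₂ ∙ (z ∙ t₂)) ∙ (t₂ ⁻¹))     ≡⟨ cong (λ v → (a ⁻¹) ∙ (v ∙ (t₂ ⁻¹))) (sym (assoc a₂ z t₂)) ⟩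
    (a ⁻¹) ∙ (((a₂ ∙ z) ∙ t₂) ∙ (t₂ ⁻¹))     ≡⟨ cong ((a ⁻¹) ∙_) (//-rightDividesʳ t₂ (a₂ ∙ z)) ⟩
    (a ⁻¹) ∙ (a₂ ∙ z)                        ≡⟨ sym (assoc (a ⁻¹) a₂ z) ⟩
    ((a ⁻¹) ∙ a₂) ∙ z                        ∎
    where
      open ≡-Reasoning
      z = doubleRep j y
      t = offset j y
      t₂ = offset j (y ∙ g)
      a = cofactor j y
      a₂ = cofactor j (y ∙ g)
      yg≡ : y ∙ g ≡ a₂ ∙ (z ∙ t₂)
      yg≡ = trans (doubleCoset-decomposition j (y ∙ g)) (cong (λ v → a₂ ∙ (v ∙ t₂)) (doubleRep-∙ʳ j y g∈))

module PermutationModule (G : FinGroup) {k : ℕ} (Hs : Fin k → Subgroup G) (H : Subgroup G) where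

  open Cochains G Hs
  open SubgroupClosure H
  open DoubleCosets G Hs H

  isMem : El → ℤ
  isMem = 𝟙 ∘ Subgroup.mem H

  ∣H∣ : ℕ
  ∣H∣ = length (filter (T? ∘ Subgroup.mem H) (allFin order))

  instance
    ∣H∣-nonZero : ℕ.NonZero ∣H∣
    ∣H∣-nonZero = ℕ.>-nonZero (Listₚ.filter-some (T? ∘ Subgroup.mem H)
                                 (lose (∈-allFin ε) (Equivalence.from Boolₚ.T-≡ ε∈)))

  sum-isMem : sum isMem ≡ + ∣H∣
  sum-isMem = sym (length-filter-tabulate (Subgroup.mem H) id)

  module _ (c : C²) (c-ind : ∀ g h → IsInd G Hs (c g h))
           (c-cocycle : IsPCocycleOn (_∈ H) c)
           (c-cyclic : ∀ {s} → s ∈ H → IsPCoboundaryOn (inCyclic G s) c) where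

    averaged : C¹
    averaged = sumSecond isMem id c

    averaged-ind : ∀ g → IsInd G Hs (averaged g)
    averaged-ind g = IsInd-sum (λ t → IsInd-* (isMem t) (c-ind g t))

    δ₁averaged : ∀ {g h} → g ∈ H → h ∈ H → ∀ i y → δ₁ averaged g h i y ≡ + ∣H∣ * c g h i y
    δ₁averaged {g} {h} g∈ h∈ i y = begin
      δ₁ averaged g h i y
        ≡⟨ δ₁-sumSecond isMem id c g h i y ⟩
      (sum isMem * c g h i y + sum (λ t → isMem t * δ₂ c g h t i y)) - (sum (λ t → isMem t * c g (h ∙ t) i y) - averaged g i y)
        ≡⟨ cong₂ (λ S∂ T → (sum isMem * c g h i y + S∂) - (T - averaged g i y)) S∂≡0 translate ⟩
      (sum isMem * c g h i y + + 0) - (averaged g i y - averaged g i y)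
        ≡⟨ cancel (sum isMem * c g h i y) (averaged g i y) ⟩
      sum isMem * c g h i y
        ≡⟨ cong (_* c g h i y) sum-isMem ⟩
      + ∣H∣ * c g h i y
        ∎
      where
        open ≡-Reasoning
        term≡0 : ∀ t → isMem t * δ₂ c g h t i y ≡ + 0
        term≡0 t with Subgroup.mem H t in t∈
        ... | true  = trans (ℤₚ.*-identityˡ _) (c-cocycle g∈ h∈ t∈ i y)
        ... | false = refl
        S∂≡0 : sum (λ t → isMem t * δ₂ c g h t i y) ≡ + 0
        S∂≡0 = sum-zero _ term≡0
        translate : sum (λ t → isMem t * c g (h ∙ t) i y) ≡ averaged g i y
        translate = trans (sum-cong-≗ (λ t → cong (λ b → 𝟙 b * c g (h ∙ t) i y) (sym (mem-∙ˡ t h∈))))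
                          (sum-reindex (λ t → isMem t * c g t i y) (h ∙_) ((h ⁻¹) ∙_) (\\-leftDividesˡ h) (\\-leftDividesʳ h))
        cancel : ∀ a b → (a + + 0) - (b - b) ≡ a
        cancel = solve-∀

    averaged-divisible : ∀ {s j z a} → s ∈ H → a ∈ Hs j → z ∙ s ≡ a ∙ z → + ∣H∣ ∣ averaged s j z
    averaged-divisible {s} {j} {z} s∈ a∈ zs≡az with c-cyclic s∈
    ... | b , b-ind , c≡δ₁b = divides (b s j z) (begin
      averaged s j z   ≡⟨ ℤₚ.i-j≡0⇒i≡j _ _ (cocycle-vanishes-on-stabilizer f f-ind f-cocycle a∈ zs≡az) ⟩
      + ∣H∣ * b s j z  ≡⟨ ℤₚ.*-comm (+ ∣H∣) (b s j z) ⟩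
      b s j z * + ∣H∣  ∎)
      where
        open ≡-Reasoning
        f : C¹
        f g i y = averaged g i y - + ∣H∣ * b g i y
        f-ind : ∀ g → IsInd G Hs (f g)
        f-ind g = IsInd-minus (averaged-ind g) (IsInd-* (+ ∣H∣) (b-ind g))
        ∈H : ∀ {g} → inCyclic G s g → g ∈ H
        ∈H (m , refl) = pow∈ m s∈
        f-cocycle : ∀ {g h} → inCyclic G s g → inCyclic G s h → ∀ i y → δ₁ f g h i y ≡ + 0
        f-cocycle {g} {h} g∈ h∈ i y = begin
          δ₁ f g h i y
            ≡⟨ δ₁-minus averaged (λ g i y → + ∣H∣ * b g i y) g h i y ⟩
          δ₁ averaged g h i y - δ₁ (λ g i y → + ∣H∣ * b g i y) g h i y
            ≡⟨ cong₂ _-_ (δ₁averaged (∈H g∈) (∈H h∈) i y) (δ₁-* (+ ∣H∣) b g h i y) ⟩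
          + ∣H∣ * c g h i y - + ∣H∣ * δ₁ b g h i y
            ≡⟨ cong (λ v → + ∣H∣ * c g h i y - + ∣H∣ * v) (sym (c≡δ₁b g∈ h∈ i y)) ⟩
          + ∣H∣ * c g h i y - + ∣H∣ * c g h i y
            ≡⟨ ℤₚ.+-inverseʳ (+ ∣H∣ * c g h i y) ⟩
          + 0
            ∎

    w : Rep G Hs
    w j y = averaged (offset j y) j (doubleRep j y)

    w-ind : IsInd G Hs w
    w-ind j a y a∈ = cong₂ (λ t z → averaged t j z) (offset-∙ˡ j y a∈) (doubleRep-∙ˡ j y a∈)

    corrected : C¹
    corrected g i y = averaged g i y - δ₀ w g i y

    corrected-ind : ∀ g → IsInd G Hs (corrected g)
    corrected-ind g = IsInd-minus (averaged-ind g) (IsInd-minus (IsInd-act g w-ind) w-ind)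

    corrected-divisible : ∀ {g} → g ∈ H → ∀ j y → + ∣H∣ ∣ corrected g j y
    corrected-divisible {g} g∈ j y =
      subst (+ ∣H∣ ∣_) (sym as-combination)
        (∣m∣n⇒∣m+n (∣m∣n⇒∣m-n (∣m⇒∣m*n _ ∣-refl) (∣m⇒∣m*n _ ∣-refl))
                    (averaged-divisible s∈ a⁻¹a₂∈ zs≡))
      where
        open ≡-Reasoning
        z = doubleRep j y
        t = offset j y
        t₂ = offset j (y ∙ g)
        t∈ : t ∈ H
        t∈ = proj₁ (offset-∈ j y)
        t₂∈ : t₂ ∈ H
        t₂∈ = proj₁ (offset-∈ j (y ∙ g))
        s = transition j y g
        s∈ : s ∈ H
        s∈ = transition-∈ j y g∈
        zs≡ = transition-stabilizes j y g∈
        a = cofactor j y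
        a∈ = cofactor-∈ j y
        a⁻¹a₂∈ = Hⱼ.∙∈ j (Hⱼ.⁻¹∈ j a∈) (cofactor-∈ j (y ∙ g))
        cocycle-at-s : (averaged t₂ j z - averaged (t ∙ g) j z) + averaged s j z ≡ + ∣H∣ * c s t₂ j z
        cocycle-at-s = begin
          (averaged t₂ j z - averaged (t ∙ g) j z) + averaged s j z
            ≡⟨ cong₂ (λ u v → (u - averaged v j z) + averaged s j z)
                     (sym (trans (cong (averaged t₂ j) zs≡) (averaged-ind t₂ j _ z a⁻¹a₂∈)))
                     (sym (transition-offset j y g)) ⟩
          δ₁ averaged s t₂ j z
            ≡⟨ δ₁averaged s∈ t₂∈ j z ⟩
          + ∣H∣ * c s t₂ j z
            ∎
        cocycle-at-t : (averaged g j y - averaged (t ∙ g) j z) + averaged t j z ≡ + ∣H∣ * c t g j z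
        cocycle-at-t = begin
          (averaged g j y - averaged (t ∙ g) j z) + averaged t j z
            ≡⟨ cong (λ u → (u - averaged (t ∙ g) j z) + averaged t j z)
                    (trans (cong (averaged g j) (doubleCoset-decomposition j y)) (averaged-ind g j a (z ∙ t) a∈)) ⟩
          δ₁ averaged t g j z
            ≡⟨ δ₁averaged t∈ g∈ j z ⟩
          + ∣H∣ * c t g j z
            ∎
        as-combination : corrected g j y ≡ (+ ∣H∣ * c t g j z - + ∣H∣ * c s t₂ j z) + averaged s j z
        as-combination = begin
          averaged g j y - (w j (y ∙ g) - w j y)
            ≡⟨ cong (λ v → averaged g j y - (averaged t₂ j v - w j y)) (doubleRep-∙ʳ j y g∈) ⟩
          averaged g j y - (averaged t₂ j z - averaged t j z)
            ≡⟨ combine (averaged g j y) (averaged t j z) (averaged t₂ j z) (averaged (t ∙ g) j z) (averaged s j z)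
                       cocycle-at-s cocycle-at-t ⟩
          (+ ∣H∣ * c t g j z - + ∣H∣ * c s t₂ j z) + averaged s j z
            ∎
          where
            combine : ∀ Ag At At₂ Atg As {e₁ e₂} → (At₂ - Atg) + As ≡ e₁ → (Ag - Atg) + At ≡ e₂ →
                      Ag - (At₂ - At) ≡ (e₂ - e₁) + As
            combine Ag At At₂ Atg As refl refl = ring Ag At At₂ Atg As
              where
                ring : ∀ Ag At At₂ Atg As → Ag - (At₂ - At) ≡ (((Ag - Atg) + At) - ((At₂ - Atg) + As)) + As
                ring = solve-∀

    β : C¹
    β g i y = exactQuotient (+ ∣H∣) (corrected g i y)

    β-ind : ∀ g → IsInd G Hs (β g)
    β-ind g i a y a∈ = cong (exactQuotient (+ ∣H∣)) (corrected-ind g i a y a∈)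

    ∣H∣*β : ∀ {g} → g ∈ H → ∀ i y → + ∣H∣ * β g i y ≡ corrected g i y
    ∣H∣*β {g} g∈ i y = trans (ℤₚ.*-comm (+ ∣H∣) (β g i y)) (sym (exactQuotient-spec (corrected-divisible g∈ i y)))

    coboundary-on-H : IsPCoboundaryOn (_∈ H) c
    coboundary-on-H = β , β-ind , λ {g} {h} g∈ h∈ i y → ℤₚ.*-cancelˡ-≡ (+ ∣H∣) _ _ (begin
      + ∣H∣ * c g h i y
        ≡⟨ sym (δ₁averaged g∈ h∈ i y) ⟩
      δ₁ averaged g h i y
        ≡⟨ sym (trans (δ₁-minus averaged (δ₀ w) g h i y)
                      (trans (cong (_-_ (δ₁ averaged g h i y)) (δ₁∘δ₀ w g h i y)) (ℤₚ.+-identityʳ _))) ⟩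
      δ₁ corrected g h i y
        ≡⟨ sym (cong₂ _+_ (cong₂ _-_ (∣H∣*β h∈ i (y ∙ g)) (∣H∣*β (∙∈ g∈ h∈) i y)) (∣H∣*β g∈ i y)) ⟩
      δ₁ (λ g i y → + ∣H∣ * β g i y) g h i y
        ≡⟨ δ₁-* (+ ∣H∣) β g h i y ⟩
      + ∣H∣ * δ₁ β g h i y
        ∎)
      where open ≡-Reasoning

module Restriction (G : FinGroup) {k : ℕ} (Hs : Fin k → Subgroup G) (i₀ : Fin k) where

  open Cochains G Hs
  open SubgroupClosure (Hs i₀)

  -- Evaluation at (i₀, ε) is an Hs i₀-invariant retraction of ⊕ Ind onto the constants;
  -- normalize is the matching lift of J into ⊕ Ind.
  normalize : Rep G Hs → Rep G Hs
  normalize u i y = u i y - u i₀ ε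

  normalize-ind : ∀ {u} → IsInd G Hs u → IsInd G Hs (normalize u)
  normalize-ind {u} u-ind i a y a∈ = cong (_- u i₀ ε) (u-ind i a y a∈)

  normalize-constant : ∀ {u} → IsConstant u → ∀ i y → normalize u i y ≡ + 0
  normalize-constant {u} (a , u≡a) i y = trans (cong₂ _-_ (u≡a i y) (u≡a i₀ ε)) (ℤₚ.+-inverseʳ a)

  normalize-minus : ∀ u v i y → normalize (_-J_ G Hs u v) i y ≡ normalize u i y - normalize v i y
  normalize-minus u v i y = identity (u i y) (v i y) (u i₀ ε) (v i₀ ε)
    where
      identity : ∀ a b a₀ b₀ → (a - b) - (a₀ - b₀) ≡ (a - a₀) - (b - b₀)
      identity = solve-∀

  ε-invariant : ∀ {u g} → IsInd G Hs u → g ∈ Hs i₀ → u i₀ (ε ∙ g) ≡ u i₀ ε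
  ε-invariant {u} {g} u-ind g∈ = trans (cong (u i₀) (trans (identityˡ g) (sym (identityʳ g)))) (u-ind i₀ g ε g∈)

  δ₁-normalize : ∀ b {g} h → g ∈ Hs i₀ → IsInd G Hs (b h) → ∀ i y →
                 δ₁ (normalize ∘ b) g h i y ≡ normalize (δ₁ b g h) i y
  δ₁-normalize b {g} h g∈ bh-ind i y =
    trans (δ₁-minus b (λ g _ _ → b g i₀ ε) g h i y)
          (cong (λ v → δ₁ b g h i y - ((v - b (g ∙ h) i₀ ε) + b g i₀ ε)) (sym (ε-invariant bh-ind g∈)))

  δ₂-normalize : ∀ c {g} h l → g ∈ Hs i₀ → IsInd G Hs (c h l) → ∀ i y →
                 δ₂ (λ g h → normalize (c g h)) g h l i y ≡ normalize (δ₂ c g h l) i y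
  δ₂-normalize c {g} h l g∈ chl-ind i y =
    trans (δ₂-minus c (λ g h _ _ → c g h i₀ ε) g h l i y)
          (cong (λ v → δ₂ c g h l i y - (((v - c (g ∙ h) l i₀ ε) + c g (h ∙ l) i₀ ε) - c g h i₀ ε))
                (sym (ε-invariant chl-ind g∈)))

  module _ (c : C²) (c-ind : ∀ g h → IsInd G Hs (c g h)) where

    ĉ : C²
    ĉ g h = normalize (c g h)

    ĉ-ind : ∀ g h → IsInd G Hs (ĉ g h)
    ĉ-ind g h = normalize-ind (c-ind g h)

    ĉ-cocycle : (∀ g h l → IsConstant (δ₂ c g h l)) → IsPCocycleOn (_∈ Hs i₀) ĉ
    ĉ-cocycle c-cocycle {g} {h} {l} g∈ _ _ i y =
      trans (δ₂-normalize c h l g∈ (c-ind h l) i y) (normalize-constant (c-cocycle g h l) i y)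

    ĉ-coboundary : ∀ {S} → (∀ {g} → S g → g ∈ Hs i₀) → IsJCoboundaryOn S c → IsPCoboundaryOn S ĉ
    ĉ-coboundary S⊆H (b , b-ind , c≈δ₁b) = normalize ∘ b , normalize-ind ∘ b-ind , λ {g} {h} g∈ h∈ i y →
      ℤₚ.i-j≡0⇒i≡j _ _ (begin
        ĉ g h i y - δ₁ (normalize ∘ b) g h i y      ≡⟨ cong (_-_ (ĉ g h i y)) (δ₁-normalize b h (S⊆H g∈) (b-ind h) i y) ⟩
        ĉ g h i y - normalize (δ₁ b g h) i y        ≡⟨ sym (normalize-minus (c g h) (δ₁ b g h) i y) ⟩
        normalize (_-J_ G Hs (c g h) (δ₁ b g h)) i y ≡⟨ normalize-constant (c≈δ₁b g∈ h∈) i y ⟩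
        + 0                                         ∎)
      where open ≡-Reasoning

    c-coboundary : ∀ {S} → IsPCoboundaryOn S ĉ → IsJCoboundaryOn S c
    c-coboundary (β , β-ind , ĉ≡δ₁β) = β , β-ind , λ {g} {h} g∈ h∈ →
      c g h i₀ ε , λ i y → trans (cong (_-_ (c g h i y)) (sym (ĉ≡δ₁β g∈ h∈ i y))) (identity (c g h i y) (c g h i₀ ε))
      where
        identity : ∀ a a₀ → a - (a - a₀) ≡ a₀
        identity = solve-∀

    restriction-splits : (∀ g h l → IsConstant (δ₂ c g h l)) → (∀ s → IsJCoboundaryOn (inCyclic G s) c) →
                         IsJCoboundaryOn (_∈ Hs i₀) c
    restriction-splits c-cocycle cyclic-coboundaries =
      c-coboundary (PermutationModule.coboundary-on-H G Hs (Hs i₀) ĉ ĉ-ind (ĉ-cocycle c-cocycle)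
                      λ {s} s∈ → ĉ-coboundary (λ { (m , refl) → pow∈ m s∈ }) (cyclic-coboundaries s))

proposition5p9 : (G : FinGroup) (k : ℕ) (Hs : Fin k → Subgroup G) (c : Cochain2 G Hs) → InSha2ω G Hs c → IsCoboundary G Hs (scale2 G Hs (gcdFam (λ i → index G (Hs i))) c)
proposition5p9 G k Hs c (cocycle , cyclic-coboundaries) =
  Annihilates⇒IsCoboundary (gcdFam indices) c (Annihilates-gcdFam indices index-annihilates)
  where
    open Cochains G Hs
    indices : Fin k → ℕ
    indices i = index G (Hs i)
    c-cocycle : ∀ g h l → IsConstant (δ₂ (proj₁ c) g h l)
    c-cocycle = IsCocycle⇒δ₂-constant c cocycle
    index-annihilates : ∀ i → Annihilates (indices i) (proj₁ c)
    index-annihilates i =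
      Corestriction.index-annihilates G Hs (Hs i) (proj₁ c) (proj₂ c) c-cocycle
        (Restriction.restriction-splits G Hs i (proj₁ c) (proj₂ c) c-cocycle
          (λ s → IsCoboundaryOnCyclic⇒IsJCoboundaryOn c (cyclic-coboundaries s)))
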